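{- Let $D_0$ be a northeast diagram and apply the canonical procedure to $D_0$. Then: (i) at no point during the procedure is it possible to apply a jump Kohnert move to the moving cell; in particular, once a cell ends its turn in the canonical procedure, it remains in that position in the resulting diagram $D_{can}$; and (ii) $D_{can}$ is a minimal element of $\mathcal{P}(D_0)$.
   Context: A diagram is a finite subset of $\mathbb{N}\times\mathbb{N}$; $(r,c)$ is a cell in row $r$, column $c$, rows numbered bottom to top. A Kohnert move on $D$ takes the rightmost cell $(r,c)$ of some row and moves it to $(r',c)$, $r'$ the largest $1\le r'<r$ with $(r',c)\notin D$ (no move if none); it is elementary if $r'=r-1$ and a jump move otherwise. $\mathcal{P}(D_0)$ is the set of diagrams obtainable from $D_0$ by finitely many Kohnert moves, ordered by the transitive closure of $D_2<D_1$ when $D_2$ results from $D_1$ by one Kohnert move. $D$ is northeast if for all cells $(r_1,c_1),(r_2,c_2)\in D$, $(\max(r_1,r_2),\max(c_1,c_2))\in D$. Canonical procedure: label each cell of $D_0$ by its row index and let labels travel with cells under elementary moves; a cell with label $i$ is an $i$-cell. For $i=2,3,\dots$ in increasing order, process the $i$-cells from right to left: the current $i$-cell (the moving cell, taking its turn) is moved down by repeated elementary Kohnert moves as far as possible (while it is the rightmost cell in its row and the position directly below it is empty and in row $\ge1$). The resulting diagram is $D_{can}$. -}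

module Defs where

open import Data.Nat using (ℕ; zero; suc; _≤_; _<_; _∸_; _⊔_; _≡ᵇ_; _≤ᵇ_)
open import Data.Bool using (Bool; true; false; if_then_else_; _∧_; _∨_; not)
open import Data.Product using (_×_; _,_; ∃; Σ)
open import Data.Sum using (_⊎_)
open import Data.List using (List; []; _∷_; map; _++_; foldr; filter; concatMap; upTo; downFrom)
open import Data.List.Membership.Propositional using (_∈_; _∉_)
open import Relation.Binary.PropositionalEquality using (_≡_; _≢_)
open import Relation.Nullary using (¬_)
open import Relation.Nullary.Decidable using (Dec)
open import Relation.Unary using (Pred)
open import Relation.Binary.Construct.Closure.ReflexiveTransitive using (Star)
open import Relation.Binary.Construct.Closure.Transitive using (TransClosure)
open import Function.Bundles using (_⇔_)
open import Data.Bool.ListAction using (all; any)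

-- A cell (r , c): row r (numbered bottom to top), column c.
Cell : Set
Cell = ℕ × ℕ

-- A diagram is a finite set of cells, represented by a list of cells
-- read as a set (membership _∈_; order and repetitions are irrelevant).
Diagram : Set
Diagram = List Cell

_≐_ : Diagram → Diagram → Set
D ≐ E = ∀ p → (p ∈ D) ⇔ (p ∈ E)

Northeast : Diagram → Set
Northeast D = ∀ r₁ c₁ r₂ c₂ → (r₁ , c₁) ∈ D → (r₂ , c₂) ∈ D → (r₁ ⊔ r₂ , c₁ ⊔ c₂) ∈ D

record KohnertMoveAt (D : Diagram) (r c r' : ℕ) (D' : Diagram) : Set where
  field
    cell-in     : (r , c) ∈ D
    rightmost   : ∀ c' → c < c' → (r , c') ∉ D
    target-pos  : 1 ≤ r'
    target-below : r' < r
    target-free : (r' , c) ∉ D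
    target-max  : ∀ s → r' < s → s < r → (s , c) ∈ D
    result      : ∀ p → (p ∈ D') ⇔ ((p ∈ D × p ≢ (r , c)) ⊎ p ≡ (r' , c))

KohnertMove : Diagram → Diagram → Set
KohnertMove D D' = Σ ℕ λ r → Σ ℕ λ c → Σ ℕ λ r' → KohnertMoveAt D r c r' D'

JumpMoveApplicable : Diagram → Cell → Set
JumpMoveApplicable D (r , c) =
  Σ ℕ λ r' → Σ Diagram λ D' → KohnertMoveAt D r c r' D' × r' < r ∸ 1

InP : Diagram → Pred Diagram _
InP D₀ D = Σ Diagram λ E → Star KohnertMove D₀ E × D ≐ E

_≺_ : Diagram → Diagram → Set
D₂ ≺ D₁ = TransClosure KohnertMove D₁ D₂

MinimalInP : Diagram → Diagram → Set
MinimalInP D₀ D = InP D₀ D × ¬ (Σ Diagram λ D' → InP D₀ D' × D' ≺ D)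

-- labelled cell (label , row , col)
LCell : Set
LCell = ℕ × ℕ × ℕ

pos : LCell → Cell
pos (i , r , c) = (r , c)

diag : List LCell → Diagram
diag = map pos

cellEqᵇ : Cell → Cell → Bool
cellEqᵇ (r , c) (r' , c') = (r ≡ᵇ r') ∧ (c ≡ᵇ c')

memᵇ : Diagram → Cell → Bool
memᵇ D p = any (cellEqᵇ p) D

rightmostᵇ : Diagram → ℕ → ℕ → Bool
rightmostᵇ D r c = all (λ { (r' , c') → not (r' ≡ᵇ r) ∨ (c' ≤ᵇ c) }) D

canStepᵇ : Diagram → ℕ → ℕ → Bool
canStepᵇ D r c = (2 ≤ᵇ r) ∧ rightmostᵇ D r c ∧ not (memᵇ D (r ∸ 1 , c))

moveDown : ℕ → ℕ → List LCell → List LCell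
moveDown i c = map (λ { (j , r , c') →
  if (j ≡ᵇ i) ∧ (c' ≡ᵇ c) then (j , r ∸ 1 , c') else (j , r , c') })

-- current row of the i-cell in column c (0 if absent)
rowOf : ℕ → ℕ → List LCell → ℕ
rowOf i c [] = 0
rowOf i c ((j , r , c') ∷ S) = if (j ≡ᵇ i) ∧ (c' ≡ᵇ c) then r else rowOf i c S

-- Returns: the configurations (diagram, position of the moving cell)
-- met during the turn (start, every intermediate one, end), the final
-- labelled state, and the final row of the moving cell.
turn : (i c r : ℕ) → List LCell → List (Diagram × Cell) × List LCell × ℕ
turn i c zero S = ((diag S , (zero , c)) ∷ [] , S , zero)
turn i c (suc r) S with canStepᵇ (diag S) (suc r) c
... | false = ((diag S , (suc r , c)) ∷ [] , S , suc r)
... | true with turn i c r (moveDown i c S)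
...   | (tr , S' , e) = ((diag S , (suc r , c)) ∷ tr , S' , e)

-- Run the turns in the given order.  Returns all configurations met,
-- the list of (label , column , row where the turn ended), final state.
runTurns : List (ℕ × ℕ) → List LCell → List (Diagram × Cell) × List (ℕ × ℕ × ℕ) × List LCell
runTurns [] S = ([] , [] , S)
runTurns ((i , c) ∷ rest) S with turn i c (rowOf i c S) S
... | (tr , S' , e) with runTurns rest S'
...   | (trs , ends , Sf) = (tr ++ trs , (i , c , e) ∷ ends , Sf)

bound : Diagram → ℕ
bound D = suc (foldr (λ { (r , c) m → r ⊔ c ⊔ m }) 0 D)

-- Order of turns: i = 2, 3, … increasing; within label i, the i-cells
-- (cells of D₀ in row i) from right to left.
turnOrder : Diagram → List (ℕ × ℕ)
turnOrder D₀ =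
  concatMap (λ i → map (λ c → (i , c)) (filter (λ c → T? (memᵇ D₀ (i , c))) (downFrom (bound D₀))))
            (filter (λ i → T? (2 ≤ᵇ i)) (upTo (bound D₀)))
  where open import Relation.Nullary.Decidable using (T?)

initLabel : Diagram → List LCell
initLabel = map (λ { (r , c) → (r , r , c) })

canonRun : Diagram → List (Diagram × Cell) × List (ℕ × ℕ × ℕ) × List LCell
canonRun D₀ = runTurns (turnOrder D₀) (initLabel D₀)

canonConfigs : Diagram → List (Diagram × Cell)
canonConfigs D₀ with canonRun D₀
... | (tr , _ , _) = tr

canonTurnEnds : Diagram → List (ℕ × ℕ × ℕ)
canonTurnEnds D₀ with canonRun D₀
... | (_ , ends , _) = ends

canonFinal : Diagram → List LCell
canonFinal D₀ with canonRun D₀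
... | (_ , _ , Sf) = Sf

Dcan : Diagram → Diagram
Dcan D₀ = diag (canonFinal D₀)

-- Every cell whose turn is over is "settled": either its column is full below it, or a cell of
-- no larger label lies to its right in its row; settled cells can never move again.  When the
-- i-cell in column c₀ is about to move down from row s+1, the cell below it (if any) has a
-- smaller label and is settled.  It cannot be blocked: its blocker has label < i and lies right
-- of c₀, so northeastness puts an i-cell in the blocker's column, in a row between s+1 and i;
-- but the moving cell was the rightmost cell of each of those rows as it passed through them.
-- Hence the column is full below the cell under the mover, so no jump is ever possible, and
-- once all turns are over every cell is settled and D_can admits no Kohnert move.
module Submission where

open import Defs
open import Data.Bool using (true; false; _∧_)
open import Data.Bool.Properties using (T-≡)
open import Data.Empty using (⊥-elim)
open import Data.List using (List; []; _∷_; map; filter; upTo; downFrom)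
open import Data.List.Membership.Propositional using (_∈_; _∉_; find; lose)
open import Data.List.Membership.Propositional.Properties
  using (∈-map⁺; ∈-map⁻; ∈-concatMap⁺; ∈-concatMap⁻; ∈-filter⁺; ∈-filter⁻; ∈-upTo⁺; ∈-downFrom⁺)
open import Data.List.Properties using (map-∘; map-id)
open import Data.List.Relation.Unary.All as All using (All; []; _∷_)
import Data.List.Relation.Unary.All.Properties as AllP
open import Data.List.Relation.Unary.AllPairs as AllPairs using (AllPairs; _∷_)
import Data.List.Relation.Unary.AllPairs.Properties as AllPairsP
open import Data.List.Relation.Unary.Any using (here; there; any?)
open import Data.Nat using (ℕ; zero; suc; _≤_; _<_; _∸_; _⊔_; _≡ᵇ_; _≤ᵇ_; s≤s; _≟_; _<?_; _≤?_)
open import Data.Nat.Properties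
open import Data.Product using (_×_; _,_; ∃; proj₁; proj₂)
open import Data.Product.Properties using (≡-dec)
open import Data.Sum using (_⊎_; inj₁; inj₂; [_,_]′)
open import Function using (id; case_of_)
open import Function.Bundles using (Equivalence; mk⇔)
open import Relation.Binary.Construct.Closure.ReflexiveTransitive using (Star; ε; _◅_; _◅◅_)
open import Relation.Binary.Construct.Closure.Transitive using ([_]; _∷_)
open import Relation.Binary.Definitions using (DecidableEquality; tri<; tri≈; tri>)
open import Relation.Binary.PropositionalEquality
open import Relation.Nullary using (¬_; yes; no)
open import Relation.Nullary.Decidable using (T?; _×-dec_)

∧≡true⁻ : ∀ {a b} → a ∧ b ≡ true → a ≡ true × b ≡ true
∧≡true⁻ {true} e = refl , e

≡ᵇ≡true⇒≡ : ∀ {m n} → (m ≡ᵇ n) ≡ true → m ≡ n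
≡ᵇ≡true⇒≡ {m} {n} e = ≡ᵇ⇒≡ m n (Equivalence.from T-≡ e)

≡ᵇ-refl : ∀ m → (m ≡ᵇ m) ≡ true
≡ᵇ-refl m = Equivalence.to T-≡ (≡⇒≡ᵇ m m refl)

_≟²_ : DecidableEquality (ℕ × ℕ)
_≟²_ = ≡-dec _≟_ _≟_

cellEqᵇ⇒≡ : ∀ {p q} → cellEqᵇ p q ≡ true → p ≡ q
cellEqᵇ⇒≡ e with ∧≡true⁻ e
... | er , ec = cong₂ _,_ (≡ᵇ≡true⇒≡ er) (≡ᵇ≡true⇒≡ ec)

cellEqᵇ-refl : ∀ p → cellEqᵇ p p ≡ true
cellEqᵇ-refl (r , c) rewrite ≡ᵇ-refl r | ≡ᵇ-refl c = refl

memᵇ⇒∈ : ∀ D {p} → memᵇ D p ≡ true → p ∈ D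
memᵇ⇒∈ [] ()
memᵇ⇒∈ (q ∷ D) {p} e with cellEqᵇ p q in eq
... | true = here (cellEqᵇ⇒≡ eq)
... | false = there (memᵇ⇒∈ D e)

∈⇒memᵇ : ∀ {D p} → p ∈ D → memᵇ D p ≡ true
∈⇒memᵇ {p = p} (here refl) rewrite cellEqᵇ-refl p = refl
∈⇒memᵇ {q ∷ D} {p} (there x) with cellEqᵇ p q
... | true = refl
... | false = ∈⇒memᵇ x

memᵇ≡false⇒∉ : ∀ {D p} → memᵇ D p ≡ false → p ∉ D
memᵇ≡false⇒∉ e x = case trans (sym e) (∈⇒memᵇ x) of λ ()

Rightmost : Diagram → ℕ → ℕ → Set
Rightmost D r c = ∀ {c'} → (r , c') ∈ D → c' ≤ c

rightmostᵇ⇒ : ∀ D {r c} → rightmostᵇ D r c ≡ true → Rightmost D r c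
rightmostᵇ⇒ (_ ∷ D) {r} {c} e {c'} (here refl) rewrite ≡ᵇ-refl r =
  ≤ᵇ⇒≤ c' c (Equivalence.from T-≡ (proj₁ (∧≡true⁻ e)))
rightmostᵇ⇒ (_ ∷ D) e (there x) = rightmostᵇ⇒ D (proj₂ (∧≡true⁻ e)) x

⇒rightmostᵇ : ∀ D {r c} → Rightmost D r c → rightmostᵇ D r c ≡ true
⇒rightmostᵇ [] h = refl
⇒rightmostᵇ ((r' , c') ∷ D) {r} h with r' ≡ᵇ r in eq
... | false = ⇒rightmostᵇ D (λ x → h (there x))
... | true with ≡ᵇ≡true⇒≡ {r'} eq
...   | refl rewrite Equivalence.to T-≡ (≤⇒≤ᵇ (h (here refl))) =
  ⇒rightmostᵇ D (λ x → h (there x))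

canStepᵇ≡true⇒ : ∀ D {s c} → canStepᵇ D s c ≡ true →
                 2 ≤ s × Rightmost D s c × (s ∸ 1 , c) ∉ D
canStepᵇ≡true⇒ D {s} {c} e
  with 2 ≤ᵇ s in e₁ | rightmostᵇ D s c in e₂ | memᵇ D (s ∸ 1 , c) in e₃
canStepᵇ≡true⇒ D {s} refl | true | true | false =
  ≤ᵇ⇒≤ 2 s (Equivalence.from T-≡ e₁) , rightmostᵇ⇒ D e₂ , memᵇ≡false⇒∉ e₃

canStepᵇ≡false⇒ : ∀ D {s c} → canStepᵇ D s c ≡ false → 2 ≤ s → Rightmost D s c →
                  (s ∸ 1 , c) ∈ D
canStepᵇ≡false⇒ D {s} {c} e 2≤s rm
  rewrite Equivalence.to T-≡ (≤⇒≤ᵇ 2≤s) | ⇒rightmostᵇ D rm with memᵇ D (s ∸ 1 , c) in e₃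
... | true = memᵇ⇒∈ D e₃
... | false = case e of λ ()

∈-diag⁺ : ∀ {S j r c} → (j , r , c) ∈ S → (r , c) ∈ diag S
∈-diag⁺ = ∈-map⁺ pos

∈-diag⁻ : ∀ {S r c} → (r , c) ∈ diag S → ∃ λ j → (j , r , c) ∈ S
∈-diag⁻ m with ∈-map⁻ pos m
... | (j , _ , _) , m' , refl = j , m'

selectsᵇ⇒≡ : ∀ {i c j c'} → (j ≡ᵇ i) ∧ (c' ≡ᵇ c) ≡ true → (j , c') ≡ (i , c)
selectsᵇ⇒≡ e with ∧≡true⁻ e
... | ej , ec = cong₂ _,_ (≡ᵇ≡true⇒≡ ej) (≡ᵇ≡true⇒≡ ec)

selectsᵇ-refl : ∀ i c → (i ≡ᵇ i) ∧ (c ≡ᵇ c) ≡ true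
selectsᵇ-refl i c rewrite ≡ᵇ-refl i | ≡ᵇ-refl c = refl

selectsᵇ≡false⇒≢ : ∀ {i c j c'} → (j ≡ᵇ i) ∧ (c' ≡ᵇ c) ≡ false → (j , c') ≢ (i , c)
selectsᵇ≡false⇒≢ {i} {c} e refl = case trans (sym e) (selectsᵇ-refl i c) of λ ()

≢⇒selectsᵇ≡false : ∀ {i c j c'} → (j , c') ≢ (i , c) → (j ≡ᵇ i) ∧ (c' ≡ᵇ c) ≡ false
≢⇒selectsᵇ≡false {i} {c} {j} {c'} ne with (j ≡ᵇ i) ∧ (c' ≡ᵇ c) in e
... | false = refl
... | true = ⊥-elim (ne (selectsᵇ⇒≡ e))

∈-moveDown⁻ : ∀ {i c} S {j r c'} → (j , r , c') ∈ moveDown i c S →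
  ((j , r , c') ∈ S × (j , c') ≢ (i , c))
  ⊎ (∃ λ r₀ → (i , r₀ , c) ∈ S × (j , r , c') ≡ (i , r₀ ∸ 1 , c))
∈-moveDown⁻ {i} {c} ((j₀ , r₀ , c₀) ∷ S) (here eq) with (j₀ ≡ᵇ i) ∧ (c₀ ≡ᵇ c) in e
∈-moveDown⁻ ((j₀ , r₀ , c₀) ∷ S) (here refl) | false =
  inj₁ (here refl , selectsᵇ≡false⇒≢ e)
∈-moveDown⁻ {i} {c} ((j₀ , r₀ , c₀) ∷ S) (here refl) | true
  with selectsᵇ⇒≡ {i} {c} {j₀} {c₀} e
... | refl = inj₂ (r₀ , here refl , refl)
∈-moveDown⁻ (_ ∷ S) (there m) with ∈-moveDown⁻ S m
... | inj₁ (m' , ne) = inj₁ (there m' , ne)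
... | inj₂ (r₀ , m' , eq) = inj₂ (r₀ , there m' , eq)

∈-moveDown⁺ : ∀ {i c} S {j r c'} → (j , r , c') ∈ S → (j , c') ≢ (i , c) →
              (j , r , c') ∈ moveDown i c S
∈-moveDown⁺ (_ ∷ S) (here refl) ne rewrite ≢⇒selectsᵇ≡false ne = here refl
∈-moveDown⁺ (_ ∷ S) (there m) ne = there (∈-moveDown⁺ S m ne)

∈-moveDown⁺-moved : ∀ {i c} S {r} → (i , r , c) ∈ S → (i , r ∸ 1 , c) ∈ moveDown i c S
∈-moveDown⁺-moved {i} {c} (_ ∷ S) (here refl) rewrite selectsᵇ-refl i c = here refl
∈-moveDown⁺-moved (_ ∷ S) (there m) = there (∈-moveDown⁺-moved S m)

rowOf-unique : ∀ {i c} S {r} → (i , r , c) ∈ S → (∀ {r'} → (i , r' , c) ∈ S → r' ≡ r) →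
               rowOf i c S ≡ r
rowOf-unique {i} {c} ((j , r₀ , c') ∷ S) m unique with (j ≡ᵇ i) ∧ (c' ≡ᵇ c) in e
... | true with selectsᵇ⇒≡ {i} {c} {j} {c'} e
...   | refl = unique (here refl)
rowOf-unique {i} {c} ((j , r₀ , c') ∷ S) (here refl) unique | false =
  ⊥-elim (selectsᵇ≡false⇒≢ {i} {c} e refl)
rowOf-unique ((j , r₀ , c') ∷ S) (there m) unique | false =
  rowOf-unique S m (λ m' → unique (there m'))

turnState : ℕ → ℕ → ℕ → List LCell → List LCell
turnState i c s S = proj₁ (proj₂ (turn i c s S))

runState : List (ℕ × ℕ) → List LCell → List LCell
runState order S = proj₂ (proj₂ (runTurns order S))

∈-turn-other : ∀ i c s S {j r c'} → (j , r , c') ∈ S → (j , c') ≢ (i , c) →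
               (j , r , c') ∈ turnState i c s S
∈-turn-other i c zero S m ne = m
∈-turn-other i c (suc s) S m ne with canStepᵇ (diag S) (suc s) c
... | false = m
... | true = ∈-turn-other i c s (moveDown i c S) (∈-moveDown⁺ S m ne) ne

∈-runTurns-unscheduled : ∀ order S {j r c} → (j , r , c) ∈ S → (j , c) ∉ order →
                         (j , r , c) ∈ runState order S
∈-runTurns-unscheduled [] S m _ = m
∈-runTurns-unscheduled ((i , c₀) ∷ order) S m ∉order =
  ∈-runTurns-unscheduled order _ (∈-turn-other i c₀ (rowOf i c₀ S) S m (λ eq → ∉order (here eq)))
    (λ x → ∉order (there x))

∈⇒⊔<bound : ∀ {D r c} → (r , c) ∈ D → r ⊔ c < bound D
∈⇒⊔<bound {(r , c) ∷ D} (here refl) = s≤s (m≤m⊔n (r ⊔ c) _)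
∈⇒⊔<bound {(r' , c') ∷ D} (there p) = <-≤-trans (∈⇒⊔<bound p) (s≤s (m≤n⊔m (r' ⊔ c') _))

_⊏_ : ℕ × ℕ → ℕ × ℕ → Set
(i , c) ⊏ (i' , c') = i < i' ⊎ (i ≡ i' × c' < c)

⊏-irrefl : ∀ {x} → ¬ x ⊏ x
⊏-irrefl (inj₁ lt) = <-irrefl refl lt
⊏-irrefl (inj₂ (_ , lt)) = <-irrefl refl lt

⊏-asym : ∀ {x y} → x ⊏ y → ¬ y ⊏ x
⊏-asym (inj₁ p) (inj₁ q) = <-asym p q
⊏-asym (inj₁ p) (inj₂ (refl , _)) = <-irrefl refl p
⊏-asym (inj₂ (refl , _)) (inj₁ q) = <-irrefl refl q
⊏-asym (inj₂ (refl , p)) (inj₂ (_ , q)) = <-asym p q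

module TurnOrder (D₀ : Diagram) where
  private
    columns : ℕ → List ℕ
    columns i = filter (λ c → T? (memᵇ D₀ (i , c))) (downFrom (bound D₀))

    turnsOfLabel : ℕ → List (ℕ × ℕ)
    turnsOfLabel i = map (i ,_) (columns i)

    labels : List ℕ
    labels = filter (λ i → T? (2 ≤ᵇ i)) (upTo (bound D₀))

    label-of : ∀ i {x} → x ∈ turnsOfLabel i → proj₁ x ≡ i
    label-of i p with ∈-map⁻ (i ,_) p
    ... | _ , _ , refl = refl

  ∈-turnOrder⁻ : ∀ {i c} → (i , c) ∈ turnOrder D₀ → 2 ≤ i × (i , c) ∈ D₀
  ∈-turnOrder⁻ p with find (∈-concatMap⁻ turnsOfLabel p)
  ... | i , i∈ , q with ∈-map⁻ (i ,_) q
  ... | c , c∈ , refl =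
    ≤ᵇ⇒≤ 2 i (proj₂ (∈-filter⁻ (λ i → T? (2 ≤ᵇ i)) {xs = upTo (bound D₀)} i∈)) ,
    memᵇ⇒∈ D₀ (Equivalence.to T-≡
      (proj₂ (∈-filter⁻ (λ c → T? (memᵇ D₀ (i , c))) {xs = downFrom (bound D₀)} c∈)))

  ∈-turnOrder⁺ : ∀ {i c} → (i , c) ∈ D₀ → 2 ≤ i → (i , c) ∈ turnOrder D₀
  ∈-turnOrder⁺ {i} {c} p 2≤i = ∈-concatMap⁺ turnsOfLabel (lose i∈labels (∈-map⁺ (i ,_) c∈columns))
    where
    i∈labels : i ∈ labels
    i∈labels = ∈-filter⁺ (λ i → T? (2 ≤ᵇ i)) (∈-upTo⁺ (≤-<-trans (m≤m⊔n i c) (∈⇒⊔<bound p)))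
                 (≤⇒≤ᵇ 2≤i)
    c∈columns : c ∈ columns i
    c∈columns = ∈-filter⁺ (λ c → T? (memᵇ D₀ (i , c))) (∈-downFrom⁺ (≤-<-trans (m≤n⊔m i c) (∈⇒⊔<bound p)))
                  (Equivalence.from T-≡ (∈⇒memᵇ p))

  turnOrder-sorted : AllPairs _⊏_ (turnOrder D₀)
  turnOrder-sorted = AllPairsP.concat⁺ (AllP.map⁺ (All.tabulate (λ {i} _ → within i)))
    (AllPairsP.map⁺ (AllPairs.map across
      (AllPairsP.filter⁺ (λ i → T? (2 ≤ᵇ i))
        (AllPairsP.applyUpTo⁺₁ id (bound D₀) (λ i<j _ → i<j)))))
    where
    within : ∀ i → AllPairs _⊏_ (turnsOfLabel i)
    within i = AllPairsP.map⁺ (AllPairsP.filter⁺ (λ c → T? (memᵇ D₀ (i , c)))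
      (AllPairsP.applyDownFrom⁺₁ id (bound D₀) (λ j<i _ → inj₂ (refl , j<i))))
    across : ∀ {i j} → i < j → All (λ x → All (x ⊏_) (turnsOfLabel j)) (turnsOfLabel i)
    across {i} {j} i<j =
      All.tabulate λ {x} x∈ → All.tabulate λ {y} y∈ → earlier x y (label-of i x∈) (label-of j y∈)
      where
      earlier : ∀ x y → proj₁ x ≡ i → proj₁ y ≡ j → x ⊏ y
      earlier _ _ refl refl = inj₁ i<j

open TurnOrder

FilledBelow : List LCell → ℕ → ℕ → Set
FilledBelow S r c = ∀ {t} → 1 ≤ t → t < r → ∃ λ j → (j , t , c) ∈ S

Blocked : List LCell → ℕ → ℕ → ℕ → Set
Blocked S j r c = ∃ λ j' → ∃ λ c' → (j' , r , c') ∈ S × c < c' × j' ≤ j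

Settled : List LCell → ℕ → ℕ → ℕ → Set
Settled S j r c = FilledBelow S r c ⊎ Blocked S j r c

all-settled⇒¬KohnertMove : ∀ S → (∀ {j r c} → (j , r , c) ∈ S → Settled S j r c) →
                           ∀ {D'} → ¬ KohnertMove (diag S) D'
all-settled⇒¬KohnertMove S settled (r , c , _ , K) = immobile (settled (proj₂ (∈-diag⁻ cell-in)))
  where
  open KohnertMoveAt K
  immobile : ∀ {j} → ¬ Settled S j r c
  immobile (inj₁ filled) = target-free (∈-diag⁺ (proj₂ (filled target-pos target-below)))
  immobile (inj₂ (_ , c' , m' , c<c' , _)) = rightmost c' c<c' (∈-diag⁺ m')

RelocatedCell : List LCell → ℕ → ℕ → ℕ → LCell → Set
RelocatedCell S₀ i c s (j , r , c') = ((j , r , c') ∈ S₀ × (j , c') ≢ (i , c)) ⊎ (j , r , c') ≡ (i , s , c)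

record Relocated (S₀ : List LCell) (i c s : ℕ) (S : List LCell) : Set where
  field
    origin : ∀ {j r c'} → (j , r , c') ∈ S → RelocatedCell S₀ i c s (j , r , c')
    others⁺ : ∀ {j r c'} → (j , r , c') ∈ S₀ → (j , c') ≢ (i , c) → (j , r , c') ∈ S
    mover⁺ : (i , s , c) ∈ S

open Relocated

relocated-refl : ∀ {S₀ i c s} → (i , s , c) ∈ S₀ → (∀ {r} → (i , r , c) ∈ S₀ → r ≡ s) →
                 Relocated S₀ i c s S₀
relocated-refl {S₀} {i} {c} {s} mover unique =
  record { origin = classify ; others⁺ = λ m _ → m ; mover⁺ = mover }
  where
  classify : ∀ {j r c'} → (j , r , c') ∈ S₀ → RelocatedCell S₀ i c s (j , r , c')
  classify {j} {r} {c'} m with (j , c') ≟² (i , c)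
  ... | yes refl = inj₂ (cong (λ r → i , r , c) (unique m))
  ... | no ne = inj₁ (m , ne)

relocated-moveDown : ∀ {S₀ i c s} S → Relocated S₀ i c (suc s) S → Relocated S₀ i c s (moveDown i c S)
relocated-moveDown {S₀} {i} {c} {s} S rel = record
  { origin = classify
  ; others⁺ = λ m ne → ∈-moveDown⁺ S (others⁺ rel m ne) ne
  ; mover⁺ = ∈-moveDown⁺-moved S (mover⁺ rel)
  }
  where
  classify : ∀ {j r c'} → (j , r , c') ∈ moveDown i c S → RelocatedCell S₀ i c s (j , r , c')
  classify m with ∈-moveDown⁻ S m
  ... | inj₁ (m' , ne) with origin rel m'
  ...   | inj₁ other = inj₁ other
  ...   | inj₂ refl = ⊥-elim (ne refl)
  classify m | inj₂ (_ , m' , refl) with origin rel m'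
  ...   | inj₁ (_ , ne) = ⊥-elim (ne refl)
  ...   | inj₂ refl = inj₂ refl

NoJumpAt : Diagram × Cell → Set
NoJumpAt (D , p) = ¬ JumpMoveApplicable D p

module Canonical (D₀ : Diagram) (northeast : Northeast D₀)
                 (rows≥1 : ∀ r c → (r , c) ∈ D₀ → 1 ≤ r) where

  record Invariant (pending : List (ℕ × ℕ)) (S : List LCell) : Set where
    field
      pending-sorted : AllPairs _⊏_ pending
      pending-valid : ∀ {i c} → (i , c) ∈ pending → 2 ≤ i × (i , c) ∈ D₀
      pending-upward : ∀ {t} → t ∈ pending → ∀ {j c} → (j , c) ∈ D₀ → t ⊏ (j , c) → (j , c) ∈ pending
      label-in-D₀ : ∀ {j r c} → (j , r , c) ∈ S → (j , c) ∈ D₀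
      label-present : ∀ {j c} → (j , c) ∈ D₀ → ∃ λ r → (j , r , c) ∈ S
      row-bounds : ∀ {j r c} → (j , r , c) ∈ S → 1 ≤ r × r ≤ j
      row-unique : ∀ {j r r' c} → (j , r , c) ∈ S → (j , r' , c) ∈ S → r ≡ r'
      column-ordered : ∀ {j j' r r' c} → (j , r , c) ∈ S → (j' , r' , c) ∈ S → j < j' → r < r'
      pending-unmoved : ∀ {j r c} → (j , r , c) ∈ S → (j , c) ∈ pending → r ≡ j
      done-settled : ∀ {j r c} → (j , r , c) ∈ S → (j , c) ∉ pending → Settled S j r c

  module Turn {i c₀ : ℕ} {pending : List (ℕ × ℕ)} {S₀ : List LCell}
              (inv : Invariant ((i , c₀) ∷ pending) S₀) where
    open Invariant inv

    later : All ((i , c₀) ⊏_) pending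
    later with pending-sorted
    ... | first ∷ _ = first

    2≤i : 2 ≤ i
    2≤i = proj₁ (pending-valid (here refl))

    mover-in-D₀ : (i , c₀) ∈ D₀
    mover-in-D₀ = proj₂ (pending-valid (here refl))

    mover-start : (i , i , c₀) ∈ S₀
    mover-start with label-present mover-in-D₀
    ... | r , m with pending-unmoved m (here refl)
    ...   | refl = m

    mover-row : ∀ {r} → (i , r , c₀) ∈ S₀ → r ≡ i
    mover-row m = row-unique m mover-start

    not-mover-below : ∀ {j t c} → (j , t , c) ∈ S₀ → t < i → (j , c) ≢ (i , c₀)
    not-mover-below m t<i refl = <-irrefl (mover-row m) t<i

    not-mover-right : ∀ {j c} → c₀ < c → (j , c) ≢ (i , c₀)
    not-mover-right c₀<c refl = <-irrefl refl c₀<c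

    done⇒earlier : ∀ {j r c} → (j , r , c) ∈ S₀ → (j , c) ∉ (i , c₀) ∷ pending →
                   j < i ⊎ (j ≡ i × c₀ < c)
    done⇒earlier {j} {r} {c} m done with <-cmp j i
    ... | tri< lt _ _ = inj₁ lt
    ... | tri> _ _ gt = ⊥-elim (done (pending-upward (here refl) (label-in-D₀ m) (inj₁ gt)))
    ... | tri≈ _ refl _ with <-cmp c₀ c
    ...   | tri< lt _ _ = inj₂ (refl , lt)
    ...   | tri≈ _ refl _ = ⊥-elim (done (here refl))
    ...   | tri> _ _ gt = ⊥-elim (done (pending-upward (here refl) (label-in-D₀ m) (inj₂ (refl , gt))))

    lower-label-done : ∀ {j c} → j < i → (j , c) ∉ (i , c₀) ∷ pending
    lower-label-done lt (here refl) = <-irrefl refl lt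
    lower-label-done lt (there m) with All.lookup later m
    ... | inj₁ gt = <-asym lt gt
    ... | inj₂ (refl , _) = <-irrefl refl lt

    higher-label-unmoved : ∀ {j r c} → (j , r , c) ∈ S₀ → i < j → r ≡ j
    higher-label-unmoved m i<j = pending-unmoved m (pending-upward (here refl) (label-in-D₀ m) (inj₁ i<j))

    RightClear : ℕ → Set
    RightClear s = ∀ {t j c} → s < t → t ≤ i → (j , t , c) ∈ S₀ → ¬ c₀ < c

    ColumnClear : ℕ → Set
    ColumnClear s = ∀ {t j} → s ≤ t → t ≤ i → (j , t , c₀) ∈ S₀ → j ≡ i

    RowClear : ℕ → Set
    RowClear s = ∀ {j c} → (j , s , c) ∈ S₀ → ¬ c₀ < c

    right-clear-start : RightClear i
    right-clear-start i<t t≤i _ _ = <⇒≱ i<t t≤i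

    column-clear-start : ColumnClear i
    column-clear-start {j = j} i≤t t≤i m with ≤-antisym t≤i i≤t
    ... | refl with <-cmp j i
    ...   | tri< lt _ _ = ⊥-elim (<-irrefl refl (column-ordered m mover-start lt))
    ...   | tri≈ _ eq _ = eq
    ...   | tri> _ _ gt = ⊥-elim (<-irrefl refl (column-ordered mover-start m gt))

    occupant-below-filled : ∀ {s jx} → suc s ≤ i → RightClear (suc s) → RowClear (suc s) →
                            (jx , s , c₀) ∈ S₀ → FilledBelow S₀ s c₀
    occupant-below-filled {s} {jx} s<i clear row-clear X =
      [ id , (λ blocked → ⊥-elim (not-blocked blocked)) ]′ (done-settled X (lower-label-done jx<i))
      where
      jx<i : jx < i
      jx<i with <-cmp jx i
      ... | tri< lt _ _ = lt
      ... | tri≈ _ refl _ = ⊥-elim (<-irrefl (mover-row X) s<i)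
      ... | tri> _ _ gt = ⊥-elim (<-asym (column-ordered mover-start X gt) s<i)

      no-i-cell-right : ∀ {r cy} → (i , r , cy) ∈ S₀ → c₀ < cy → ¬ s < r
      no-i-cell-right Z c₀<cy s<r with m≤n⇒m<n∨m≡n s<r
      ... | inj₁ lt = clear lt (proj₂ (row-bounds Z)) Z c₀<cy
      ... | inj₂ refl = row-clear Z c₀<cy

      not-blocked : ¬ Blocked S₀ jx s c₀
      not-blocked (jy , cy , Y , c₀<cy , jy≤jx) = no-i-cell-right Z c₀<cy (column-ordered Y Z jy<i)
        where
        jy<i : jy < i
        jy<i = ≤-<-trans jy≤jx jx<i
        corner : (i , cy) ∈ D₀
        corner = subst₂ (λ a b → (a , b) ∈ D₀) (m≥n⇒m⊔n≡m (<⇒≤ jy<i)) (m≤n⇒m⊔n≡n (<⇒≤ c₀<cy))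
                   (northeast i c₀ jy cy mover-in-D₀ (label-in-D₀ Y))
        Z : (i , proj₁ (label-present corner) , cy) ∈ S₀
        Z = proj₂ (label-present corner)

    no-jump : ∀ {s S} → Relocated S₀ i c₀ s S → s ≤ i → RightClear s → NoJumpAt (diag S , (s , c₀))
    no-jump {zero} _ _ _ (_ , _ , K , _) = n≮0 (KohnertMoveAt.target-below K)
    no-jump {suc s} {S} rel s<i clear (r' , _ , K , r'<s) =
      target-free (∈-diag⁺ (others⁺ rel cell (not-mover-below cell r'<i)))
      where
      open KohnertMoveAt K
      r'<i : r' < i
      r'<i = <-trans r'<s s<i
      row-clear : RowClear (suc s)
      row-clear m c₀<c = rightmost _ c₀<c (∈-diag⁺ (others⁺ rel m (not-mover-right c₀<c)))
      occupant : ∃ λ jx → (jx , s , c₀) ∈ S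
      occupant = ∈-diag⁻ (target-max s r'<s (n<1+n s))
      occupant₀ : (proj₁ occupant , s , c₀) ∈ S₀
      occupant₀ with origin rel (proj₂ occupant)
      ... | inj₁ (m , _) = m
      ... | inj₂ ()
      cell : (proj₁ (occupant-below-filled s<i clear row-clear occupant₀ target-pos r'<s) , r' , c₀) ∈ S₀
      cell = proj₂ (occupant-below-filled s<i clear row-clear occupant₀ target-pos r'<s)

    elementary-move : ∀ {s S} → Relocated S₀ i c₀ (suc s) S → suc s ≤ i → ColumnClear (suc s) →
                      canStepᵇ (diag S) (suc s) c₀ ≡ true →
                      KohnertMoveAt (diag S) (suc s) c₀ s (diag (moveDown i c₀ S))
    elementary-move {s} {S} rel s<i column-clear can with canStepᵇ≡true⇒ (diag S) {suc s} can
    ... | 2≤suc-s , rightmost , free = record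
      { cell-in = ∈-diag⁺ (mover⁺ rel)
      ; rightmost = λ c' c₀<c' m → <⇒≱ c₀<c' (rightmost m)
      ; target-pos = ≤-pred 2≤suc-s
      ; target-below = n<1+n s
      ; target-free = free
      ; target-max = λ t s<t t<suc-s → ⊥-elim (<⇒≱ s<t (≤-pred t<suc-s))
      ; result = λ p → mk⇔ (to p) (from p)
      }
      where
      rel' = relocated-moveDown S rel
      to : ∀ p → p ∈ diag (moveDown i c₀ S) → (p ∈ diag S × p ≢ (suc s , c₀)) ⊎ p ≡ (s , c₀)
      to _ m with ∈-diag⁻ m
      ... | _ , m' with origin rel' m'
      ...   | inj₁ (m₀ , ne) = inj₁ (∈-diag⁺ (others⁺ rel m₀ ne) ,
                                      λ { refl → ne (cong (_, c₀) (column-clear ≤-refl s<i m₀)) })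
      ...   | inj₂ refl = inj₂ refl
      from : ∀ p → (p ∈ diag S × p ≢ (suc s , c₀)) ⊎ p ≡ (s , c₀) → p ∈ diag (moveDown i c₀ S)
      from _ (inj₁ (m , ne)) with ∈-diag⁻ m
      ... | _ , m' with origin rel m'
      ...   | inj₁ (m₀ , ne') = ∈-diag⁺ (others⁺ rel' m₀ ne')
      ...   | inj₂ refl = ⊥-elim (ne refl)
      from _ (inj₂ refl) = ∈-diag⁺ (mover⁺ rel')

    right-clear-step : ∀ {s S} → Relocated S₀ i c₀ (suc s) S → Rightmost (diag S) (suc s) c₀ →
                       RightClear (suc s) → RightClear s
    right-clear-step rel rightmost clear s<t t≤i m c₀<c with m≤n⇒m<n∨m≡n s<t
    ... | inj₁ lt = clear lt t≤i m c₀<c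
    ... | inj₂ refl = <⇒≱ c₀<c (rightmost (∈-diag⁺ (others⁺ rel m (not-mover-right c₀<c))))

    column-clear-step : ∀ {s S} → Relocated S₀ i c₀ (suc s) S → suc s ≤ i → (s , c₀) ∉ diag S →
                        ColumnClear (suc s) → ColumnClear s
    column-clear-step rel s<i free column-clear s≤t t≤i m with m≤n⇒m<n∨m≡n s≤t
    ... | inj₁ lt = column-clear lt t≤i m
    ... | inj₂ refl = ⊥-elim (free (∈-diag⁺ (others⁺ rel m (not-mover-below m s<i))))

    record Stopped (e : ℕ) (S : List LCell) : Set where
      field
        moved : Relocated S₀ i c₀ e S
        1≤e : 1 ≤ e
        e≤i : e ≤ i
        right-clear : RightClear e
        column-clear : ColumnClear e
        stuck : canStepᵇ (diag S) e c₀ ≡ false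

    record TurnOutcome (S : List LCell) (T : List (Diagram × Cell) × List LCell × ℕ) : Set where
      field
        no-jumps : All NoJumpAt (proj₁ T)
        stopped : Stopped (proj₂ (proj₂ T)) (proj₁ (proj₂ T))
        moves : Star KohnertMove (diag S) (diag (proj₁ (proj₂ T)))

    turn-outcome : ∀ s S → Relocated S₀ i c₀ s S → 1 ≤ s → s ≤ i → RightClear s → ColumnClear s →
                   TurnOutcome S (turn i c₀ s S)
    turn-outcome (suc s) S rel 1≤e s<i clear column-clear with canStepᵇ (diag S) (suc s) c₀ in can
    ... | false = record
      { no-jumps = no-jump rel s<i clear ∷ []
      ; stopped = record { moved = rel ; 1≤e = 1≤e ; e≤i = s<i ; right-clear = clear
                         ; column-clear = column-clear ; stuck = can }
      ; moves = ε
      }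
    ... | true with canStepᵇ≡true⇒ (diag S) {suc s} can
    ...   | 2≤suc-s , rightmost , free = record
      { no-jumps = no-jump rel s<i clear ∷ TurnOutcome.no-jumps rest
      ; stopped = TurnOutcome.stopped rest
      ; moves = (suc s , c₀ , s , elementary-move rel s<i column-clear can) ◅ TurnOutcome.moves rest
      }
      where
      rest = turn-outcome s (moveDown i c₀ S) (relocated-moveDown S rel) (≤-pred 2≤suc-s) (<⇒≤ s<i)
               (right-clear-step rel rightmost clear) (column-clear-step rel s<i free column-clear)

    stuck-mover-filled : ∀ {s S} → Stopped (suc s) S → 2 ≤ suc s → Rightmost (diag S) (suc s) c₀ →
                         FilledBelow S (suc s) c₀
    stuck-mover-filled {s} {S} st 2≤e rightmost = filled
      where
      open Stopped st
      occupant : ∃ λ jx → (jx , s , c₀) ∈ S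
      occupant = ∈-diag⁻ (canStepᵇ≡false⇒ (diag S) stuck 2≤e rightmost)
      occupant₀ : (proj₁ occupant , s , c₀) ∈ S₀
      occupant₀ with origin moved (proj₂ occupant)
      ... | inj₁ (m , _) = m
      ... | inj₂ ()
      row-clear : RowClear (suc s)
      row-clear m c₀<c = <⇒≱ c₀<c (rightmost (∈-diag⁺ (others⁺ moved m (not-mover-right c₀<c))))
      filled : FilledBelow S (suc s) c₀
      filled 1≤t t<e with m≤n⇒m<n∨m≡n (≤-pred t<e)
      ... | inj₂ refl = occupant
      ... | inj₁ t<s with occupant-below-filled e≤i right-clear row-clear occupant₀ 1≤t t<s
      ...   | j , m = j , others⁺ moved m (not-mover-below m (<-trans t<s e≤i))

    stopped-mover-settled : ∀ {e S} → Stopped e S → Settled S i e c₀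
    stopped-mover-settled {e} {S} st with 2 ≤? e
    ... | no e≱2 = inj₁ (λ 1≤t t<e → ⊥-elim (e≱2 (≤-trans (s≤s 1≤t) t<e)))
    ... | yes 2≤e@(s≤s _) with any? (λ x → (proj₁ (proj₂ x) ≟ e) ×-dec (c₀ <? proj₂ (proj₂ x))) S
    ...   | yes cell-right with find cell-right
    ...     | (j , _ , c) , m , refl , c₀<c = inj₂ (j , c , m , c₀<c , right-label≤i)
      where
      open Stopped st
      right-label≤i : j ≤ i
      right-label≤i with origin moved m | j ≤? i
      ... | _ | yes j≤i = j≤i
      ... | inj₂ refl | no _ = ⊥-elim (<-irrefl refl c₀<c)
      ... | inj₁ (m₀ , _) | no j≰i =
        ⊥-elim (<⇒≱ (≰⇒> j≰i) (subst (_≤ i) (higher-label-unmoved m₀ (≰⇒> j≰i)) e≤i))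
    stopped-mover-settled {e} {S} st | yes 2≤e@(s≤s _) | no none =
      inj₁ (stuck-mover-filled st 2≤e rightmost)
      where
      rightmost : Rightmost (diag S) e c₀
      rightmost m with ∈-diag⁻ m
      ... | _ , m' = ≮⇒≥ (λ c₀<c → none (lose m' (refl , c₀<c)))

    settled-other : ∀ {e S j r c} → Stopped e S → (j , r , c) ∈ S₀ → (j , c) ≢ (i , c₀) →
                    (j , c) ∉ pending → Settled S j r c
    settled-other {S = S} {j} {r} {c} st m₀ ne done = transfer (done-settled m₀ done')
      where
      open Stopped st
      done' : (j , c) ∉ (i , c₀) ∷ pending
      done' (here eq) = ne eq
      done' (there x) = done x
      earlier : j < i ⊎ (j ≡ i × c₀ < c)
      earlier = done⇒earlier m₀ done'
      j≤i : j ≤ i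
      j≤i = [ <⇒≤ , (λ p → ≤-reflexive (proj₁ p)) ]′ earlier
      blocker-not-mover : ∀ {jy cy} → jy ≤ j → c < cy → (jy , cy) ≢ (i , c₀)
      blocker-not-mover jy≤j c<cy refl with earlier
      ... | inj₁ j<i = <-irrefl refl (≤-<-trans jy≤j j<i)
      ... | inj₂ (_ , c₀<c) = <-irrefl refl (<-trans c₀<c c<cy)
      transfer : Settled S₀ j r c → Settled S j r c
      transfer (inj₁ filled) = inj₁ λ 1≤t t<r → let (j' , m) = filled 1≤t t<r in
        j' , others⁺ moved m (not-mover-below m (<-≤-trans t<r (≤-trans (proj₂ (row-bounds m₀)) j≤i)))
      transfer (inj₂ (jy , cy , Y , c<cy , jy≤j)) =
        inj₂ (jy , cy , others⁺ moved Y (blocker-not-mover jy≤j c<cy) , c<cy , jy≤j)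

    module After {e S} (st : Stopped e S) where
      open Stopped st

      pending-upward′ : ∀ {t} → t ∈ pending → ∀ {j c} → (j , c) ∈ D₀ → t ⊏ (j , c) → (j , c) ∈ pending
      pending-upward′ t∈ jc t⊏jc with pending-upward (there t∈) jc t⊏jc
      ... | here refl = ⊥-elim (⊏-asym (All.lookup later t∈) t⊏jc)
      ... | there m = m

      label-in-D₀′ : ∀ {j r c} → (j , r , c) ∈ S → (j , c) ∈ D₀
      label-in-D₀′ m with origin moved m
      ... | inj₁ (m₀ , _) = label-in-D₀ m₀
      ... | inj₂ refl = mover-in-D₀

      label-present′ : ∀ {j c} → (j , c) ∈ D₀ → ∃ λ r → (j , r , c) ∈ S
      label-present′ {j} {c} jc with (j , c) ≟² (i , c₀)
      ... | yes refl = e , mover⁺ moved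
      ... | no ne = proj₁ (label-present jc) , others⁺ moved (proj₂ (label-present jc)) ne

      row-bounds′ : ∀ {j r c} → (j , r , c) ∈ S → 1 ≤ r × r ≤ j
      row-bounds′ m with origin moved m
      ... | inj₁ (m₀ , _) = row-bounds m₀
      ... | inj₂ refl = 1≤e , e≤i

      row-unique′ : ∀ {j r r' c} → (j , r , c) ∈ S → (j , r' , c) ∈ S → r ≡ r'
      row-unique′ m m' with origin moved m | origin moved m'
      ... | inj₁ (x , _) | inj₁ (y , _) = row-unique x y
      ... | inj₂ refl | inj₂ refl = refl
      ... | inj₁ (_ , ne) | inj₂ refl = ⊥-elim (ne refl)
      ... | inj₂ refl | inj₁ (_ , ne) = ⊥-elim (ne refl)

      column-ordered′ : ∀ {j j' r r' c} → (j , r , c) ∈ S → (j' , r' , c) ∈ S → j < j' → r < r'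
      column-ordered′ m m' j<j' with origin moved m | origin moved m'
      ... | inj₁ (x , _) | inj₁ (y , _) = column-ordered x y j<j'
      ... | inj₂ refl | inj₁ (y , _) = ≤-<-trans e≤i (column-ordered mover-start y j<j')
      ... | inj₂ refl | inj₂ refl = ⊥-elim (<-irrefl refl j<j')
      ... | inj₁ (x , _) | inj₂ refl =
        ≰⇒> (λ e≤r → <-irrefl (column-clear e≤r (<⇒≤ (column-ordered x mover-start j<j')) x) j<j')

      pending-unmoved′ : ∀ {j r c} → (j , r , c) ∈ S → (j , c) ∈ pending → r ≡ j
      pending-unmoved′ m jc with origin moved m
      ... | inj₁ (m₀ , _) = pending-unmoved m₀ (there jc)
      ... | inj₂ refl = ⊥-elim (⊏-irrefl (All.lookup later jc))

      done-settled′ : ∀ {j r c} → (j , r , c) ∈ S → (j , c) ∉ pending → Settled S j r c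
      done-settled′ m done with origin moved m
      ... | inj₁ (m₀ , ne) = settled-other st m₀ ne done
      ... | inj₂ refl = stopped-mover-settled st

      invariant : Invariant pending S
      invariant = record
        { pending-sorted = AllPairs.tail pending-sorted
        ; pending-valid = λ m → pending-valid (there m)
        ; pending-upward = pending-upward′
        ; label-in-D₀ = label-in-D₀′
        ; label-present = label-present′
        ; row-bounds = row-bounds′
        ; row-unique = row-unique′
        ; column-ordered = column-ordered′
        ; pending-unmoved = pending-unmoved′
        ; done-settled = done-settled′
        }

  record RunOutcome (S : List LCell) (R : List (Diagram × Cell) × List (ℕ × ℕ × ℕ) × List LCell) :
                    Set where
    field
      no-jumps : All NoJumpAt (proj₁ R)
      ends-kept : ∀ {i c e} → (i , c , e) ∈ proj₁ (proj₂ R) → (i , e , c) ∈ proj₂ (proj₂ R)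
      moves : Star KohnertMove (diag S) (diag (proj₂ (proj₂ R)))
      final : Invariant [] (proj₂ (proj₂ R))

  run-outcome : ∀ order S → Invariant order S → RunOutcome S (runTurns order S)
  run-outcome [] S inv = record { no-jumps = [] ; ends-kept = λ () ; moves = ε ; final = inv }
  run-outcome ((i , c₀) ∷ order) S inv = record
    { no-jumps = AllP.++⁺ (TurnOutcome.no-jumps this) (RunOutcome.no-jumps rest)
    ; ends-kept = ends-kept
    ; moves = TurnOutcome.moves this ◅◅ RunOutcome.moves rest
    ; final = RunOutcome.final rest
    }
    where
    open Turn inv
    this : TurnOutcome S (turn i c₀ (rowOf i c₀ S) S)
    this = subst (λ s → TurnOutcome S (turn i c₀ s S)) (sym (rowOf-unique S mover-start mover-row))
             (turn-outcome i S (relocated-refl mover-start mover-row) (<⇒≤ 2≤i) ≤-refl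
                right-clear-start column-clear-start)
    rest = run-outcome order _ (After.invariant (TurnOutcome.stopped this))
    ends-kept : ∀ {i' c e} → (i' , c , e) ∈ proj₁ (proj₂ (runTurns ((i , c₀) ∷ order) S)) →
                (i' , e , c) ∈ runState ((i , c₀) ∷ order) S
    ends-kept (here refl) =
      ∈-runTurns-unscheduled order _ (mover⁺ (Stopped.moved (TurnOutcome.stopped this)))
        (λ m → ⊏-irrefl (All.lookup later m))
    ends-kept (there m) = RunOutcome.ends-kept rest m

  ∈-initLabel⁻ : ∀ {j r c} → (j , r , c) ∈ initLabel D₀ → (r , c) ∈ D₀ × j ≡ r
  ∈-initLabel⁻ m with ∈-map⁻ (λ { (r , c) → (r , r , c) }) m
  ... | _ , m₀ , refl = m₀ , refl

  initial-invariant : Invariant (turnOrder D₀) (initLabel D₀)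
  initial-invariant = record
    { pending-sorted = turnOrder-sorted D₀
    ; pending-valid = ∈-turnOrder⁻ D₀
    ; pending-upward = upward
    ; label-in-D₀ = λ m → let (m₀ , j≡r) = ∈-initLabel⁻ m in subst (λ j → (j , _) ∈ D₀) (sym j≡r) m₀
    ; label-present = λ jc → _ , ∈-map⁺ (λ { (r , c) → (r , r , c) }) jc
    ; row-bounds = λ m → let (m₀ , j≡r) = ∈-initLabel⁻ m in rows≥1 _ _ m₀ , ≤-reflexive (sym j≡r)
    ; row-unique = λ m m' → trans (sym (proj₂ (∈-initLabel⁻ m))) (proj₂ (∈-initLabel⁻ m'))
    ; column-ordered = λ m m' → subst₂ _<_ (proj₂ (∈-initLabel⁻ m)) (proj₂ (∈-initLabel⁻ m'))
    ; pending-unmoved = λ m _ → sym (proj₂ (∈-initLabel⁻ m))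
    ; done-settled = unscheduled-settled
    }
    where
    upward : ∀ {t} → t ∈ turnOrder D₀ → ∀ {j c} → (j , c) ∈ D₀ → t ⊏ (j , c) → (j , c) ∈ turnOrder D₀
    upward {a , b} t∈ {j} jc t⊏jc =
      ∈-turnOrder⁺ D₀ jc (≤-trans (proj₁ (∈-turnOrder⁻ D₀ t∈)) (label≤ t⊏jc))
      where
      label≤ : (a , b) ⊏ (j , _) → a ≤ j
      label≤ (inj₁ a<j) = <⇒≤ a<j
      label≤ (inj₂ (refl , _)) = ≤-refl
    -- Unscheduled cells lie in row 1, where FilledBelow holds vacuously.
    unscheduled-settled : ∀ {j r c} → (j , r , c) ∈ initLabel D₀ → (j , c) ∉ turnOrder D₀ →
                          Settled (initLabel D₀) j r c
    unscheduled-settled {r = r} m unscheduled with ∈-initLabel⁻ m | 2 ≤? r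
    ... | m₀ , refl | yes 2≤r = ⊥-elim (unscheduled (∈-turnOrder⁺ D₀ m₀ 2≤r))
    ... | _ , refl | no r≱2 = inj₁ λ 1≤t t<r → ⊥-elim (r≱2 (≤-trans (s≤s 1≤t) t<r))

diag-initLabel : ∀ D → diag (initLabel D) ≡ D
diag-initLabel D = trans (sym (map-∘ D)) (map-id D)

lemma5p1 : (D₀ : Diagram) → Northeast D₀ → (∀ r c → (r , c) ∈ D₀ → 1 ≤ r) →
    ((∀ D p → (D , p) ∈ canonConfigs D₀ → ¬ JumpMoveApplicable D p)
      × (∀ i c r → (i , c , r) ∈ canonTurnEnds D₀ → (i , r , c) ∈ canonFinal D₀))
    × MinimalInP D₀ (Dcan D₀)
lemma5p1 D₀ northeast rows≥1 = (no-jumps , ends-kept) , (reachable , nothing-below)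
  where
  open Canonical D₀ northeast rows≥1
  outcome = run-outcome (turnOrder D₀) (initLabel D₀) initial-invariant
  open RunOutcome outcome using (final; moves)

  no-jumps : ∀ D p → (D , p) ∈ canonConfigs D₀ → ¬ JumpMoveApplicable D p
  no-jumps _ _ = All.lookup (RunOutcome.no-jumps outcome)

  ends-kept : ∀ i c r → (i , c , r) ∈ canonTurnEnds D₀ → (i , r , c) ∈ canonFinal D₀
  ends-kept _ _ _ = RunOutcome.ends-kept outcome

  reachable : InP D₀ (Dcan D₀)
  reachable = Dcan D₀ , subst (λ D → Star KohnertMove D (Dcan D₀)) (diag-initLabel D₀) moves , λ _ → mk⇔ id id

  immobile : ∀ {D'} → ¬ KohnertMove (Dcan D₀) D'
  immobile = all-settled⇒¬KohnertMove _ (λ m → Invariant.done-settled final m λ ())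

  nothing-below : ¬ (∃ λ D' → InP D₀ D' × D' ≺ Dcan D₀)
  nothing-below (_ , _ , [ move ]) = immobile move
  nothing-below (_ , _ , move ∷ _) = immobile move
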